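{- Let $n\ge1$ and $\sigma=\sigma_1\cdots\sigma_n\in S_n$. Define $\mathcal C(\sigma)=C^{\sigma_n}(\sigma_1\sigma_2\cdots\sigma_{n-1})\in S_{n-1}$ and $L(\sigma)=\sigma_n$, and let $\mathcal C^0(\sigma)=\sigma$, $\mathcal C^k(\sigma)=\mathcal C(\mathcal C^{k-1}(\sigma))$ (so $\mathcal C^{n-i}(\sigma)\in S_i$). Then for $1\le i\le n$, \[ s_i(\sigma)=i-L(\mathcal C^{n-i}(\sigma)).\]
   Context: $S_n$ is the set of permutations of $[n]$ in one-line notation. Cyclic intervals: for $x,y\in[n]$, $\rrbracket x,y\rrbracket=\{z\in[n]:x<z\le y\}$ if $x\le y$, and $\{z\in[n]: z>x\text{ or }z\le y\}$ if $x>y$; $\rrbracket x,\infty\rrbracket=\{z\in[n]:z>x\}$. For $\sigma\in S_n$, $s_i(\sigma)=\#\{j: 1\le j\le i-1,\ \sigma_j\in\rrbracket\sigma_i,\sigma_{i+1}\rrbracket\}$ with $\sigma_{n+1}=\infty$ (the $i$-th entry of the cyclic major code). For $x\in[n]$ and a permutation $\sigma=\sigma_1\cdots\sigma_{n-1}$ of $[n]\setminus\{x\}$, $C^x(\sigma)=\tau_1\cdots\tau_{n-1}\in S_{n-1}$ where $\tau_i=\sigma_i-x+n$ if $\sigma_i<x$ and $\tau_i=\sigma_i-x$ if $\sigma_i>x$. -}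

module Defs where

open import Data.Nat using (ℕ; zero; suc; _+_; _∸_; _<ᵇ_; _≤ᵇ_)
open import Data.Bool using (Bool; true; false; if_then_else_; _∧_; _∨_)
open import Data.Maybe using (Maybe; just; nothing)
open import Data.Product using (_×_; _,_)
open import Data.List using (List; []; _∷_; length; map; upTo; take; drop; filterᵇ; unsnoc)
open import Data.List.Relation.Binary.Permutation.Propositional using (_↭_)

range : ℕ → List ℕ
range n = map suc (upTo n)

-- σ ∈ S_n in one-line notation: a list that is a rearrangement of [n]
IsPerm : ℕ → List ℕ → Set
IsPerm n σ = σ ↭ range n

-- membership z ∈ ⟧x, y⟧ (cyclic interval); y = nothing encodes ∞
inCyc : ℕ → Maybe ℕ → ℕ → Bool
inCyc x nothing  z = x <ᵇ z
inCyc x (just y) z =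
  if x ≤ᵇ y then (x <ᵇ z) ∧ (z ≤ᵇ y) else ((x <ᵇ z) ∨ (z ≤ᵇ y))

-- s_i(σ) (1-based i), with σ_{n+1} = ∞
sCode : ℕ → List ℕ → ℕ
sCode i σ = go (drop (i ∸ 1) σ)
  where
  prefix : List ℕ
  prefix = take (i ∸ 1) σ
  go : List ℕ → ℕ
  go []           = 0
  go (a ∷ [])     = length (filterᵇ (inCyc a nothing) prefix)
  go (a ∷ b ∷ _)  = length (filterᵇ (inCyc a (just b)) prefix)

-- C^x(σ) for σ a permutation of [n] \ {x}, where n = length σ + 1
Cx : ℕ → List ℕ → List ℕ
Cx x σ = map (λ v → if v <ᵇ x then v + n ∸ x else v ∸ x) σ
  where
  n : ℕ
  n = suc (length σ)

-- 𝒞(σ) = C^{σ_n}(σ_1 ⋯ σ_{n-1}); on the empty word (never used) returns []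
𝒞 : List ℕ → List ℕ
𝒞 σ with unsnoc σ
... | nothing        = []
... | just (ρ , x)   = Cx x ρ

𝒞^ : ℕ → List ℕ → List ℕ
𝒞^ zero    σ = σ
𝒞^ (suc k) σ = 𝒞 (𝒞^ k σ)

module Submission where

-- Split σ = ρ a r with |ρ| = i − 1 and let p be the letter after a (p = ∞ when r is empty).
-- Then 𝒞^{|r|}(σ) is the word ρ a with every letter u replaced by its cyclic rank
-- #{z ∈ ρ a : z ∈ ⟧p, u⟧}; for r empty this is σ itself, as ⟧∞, u⟧ ∩ [n] = [u].
-- One step of 𝒞 drops the last letter a and re-bases the cyclic ranks at a: for v ∈ ρ,
-- either ⟧p, v⟧ = ⟧p, a⟧ ⊔ ⟧a, v⟧, so the rank drops by that of a, or
-- ⟧p, a⟧ = ⟧p, v⟧ ⊔ ⟧v, a⟧, and since ⟧a, v⟧ and ⟧v, a⟧ partition ℕ this is exactly the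
-- wrap-around case of C^a. So the last letter of 𝒞^{n−i}(σ) counts ρ a in ⟧p, a⟧, while
-- s_i(σ) counts it in ⟧a, p⟧, and the two add up to i.
-- The facts about cyclic intervals only depend on the relative order of at most four
-- numbers; replacing the numbers by their ranks among themselves reduces them to a
-- finite check.

open import Defs
open import Algebra.Properties.CommutativeSemigroup using (interchange)
open import Data.Bool using (Bool; true; false; T; not; if_then_else_; _∧_; _∨_)
open import Data.Bool.Properties using (∨-identityʳ)
open import Data.Empty using (⊥-elim)
open import Data.List using (List; []; _∷_; [_]; _++_; _∷ʳ_; length; map; upTo; take; drop; filterᵇ; initLast; _∷ʳ′_; last)
open import Data.List.Properties using (length-++; length-map; length-upTo; map-++; map-∘; map-cong-local; map-id-local; ++-assoc; ++-identityʳ; upTo-∷ʳ; last-map)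
open import Data.List.Membership.Propositional using (_∈_; _∉_)
open import Data.List.Membership.Propositional.Properties using (∈-++⁺ˡ; ∈-insert; ∈-map⁻; ∈-upTo⁻)
open import Data.List.Relation.Unary.All as All using (All; []; _∷_)
open import Data.List.Relation.Unary.Any using (here; there)
open import Data.List.Relation.Unary.Unique.Propositional using (Unique; _∷_)
import Data.List.Relation.Unary.Unique.Propositional.Properties as Unique
open import Data.List.Relation.Binary.Permutation.Propositional using (_↭_; ↭-sym; ↭⇒↭ₛ)
open import Data.List.Relation.Binary.Permutation.Propositional.Properties using (↭-length; filter-↭; ∈-resp-↭)
open import Data.List.Relation.Binary.Permutation.Setoid.Properties using (Unique-resp-↭)
open import Data.Maybe using (just)
import Data.Maybe as Maybe
open import Data.Nat using (ℕ; zero; suc; _+_; _∸_; _≤_; _<_; _<ᵇ_; _≤ᵇ_; _⊓_; z≤n; s≤s)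
open import Data.Nat.Properties
open import Data.Product using (∃; ∃₂; _×_; _,_; proj₁; proj₂)
open import Data.Sum using (_⊎_; inj₁; inj₂)
import Data.Sum as Sum
open import Function using (_∘_)
open import Relation.Binary using (tri<; tri≈; tri>)
open import Relation.Binary.PropositionalEquality using (_≡_; _≢_; refl; sym; trans; cong; cong₂; subst; setoid; module ≡-Reasoning)
open import Relation.Nullary using (¬_; Dec)
open import Relation.Nullary.Decidable using (toWitness; _→-dec_; _⊎-dec_; ¬?; T?)
open ≡-Reasoning

⟦_⟧ : Bool → ℕ
⟦ true ⟧  = 1
⟦ false ⟧ = 0

⟦⟧-mono : ∀ {b c} → (T b → T c) → ⟦ b ⟧ ≤ ⟦ c ⟧
⟦⟧-mono {false}         _   = z≤n
⟦⟧-mono {true}  {true}  _   = ≤-refl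
⟦⟧-mono {true}  {false} b⇒c = ⊥-elim (b⇒c _)

⟦⟧-< : ∀ {b c} → ¬ T b → T c → ⟦ b ⟧ < ⟦ c ⟧
⟦⟧-< {false} {true} _  _ = s≤s z≤n
⟦⟧-< {true}         ¬b _ = ⊥-elim (¬b _)

⟦⟧≡1⇒T : ∀ {b} → ⟦ b ⟧ ≡ 1 → T b
⟦⟧≡1⇒T {true} _ = _

T-⇔⇒≡ : ∀ {b c} → (T b → T c) → (T c → T b) → b ≡ c
T-⇔⇒≡ {false} {false} _   _   = refl
T-⇔⇒≡ {false} {true}  _   c⇒b = ⊥-elim (c⇒b _)
T-⇔⇒≡ {true}  {false} b⇒c _   = ⊥-elim (b⇒c _)
T-⇔⇒≡ {true}  {true}  _   _   = refl

<ᵇ-true : ∀ {m n} → m < n → (m <ᵇ n) ≡ true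
<ᵇ-true m<n = T-⇔⇒≡ _ (λ _ → <⇒<ᵇ m<n)

<ᵇ-false : ∀ {m n} → ¬ m < n → (m <ᵇ n) ≡ false
<ᵇ-false {m} {n} m≮n = T-⇔⇒≡ (m≮n ∘ <ᵇ⇒< m n) (λ ())

≤ᵇ≡not<ᵇ : ∀ m n → (m ≤ᵇ n) ≡ not (n <ᵇ m)
≤ᵇ≡not<ᵇ zero          n       = refl
≤ᵇ≡not<ᵇ (suc m)       zero    = refl
≤ᵇ≡not<ᵇ (suc zero)    (suc n) = ≤ᵇ≡not<ᵇ zero n
≤ᵇ≡not<ᵇ (suc (suc m)) (suc n) = ≤ᵇ≡not<ᵇ (suc m) n

-- Counting

count : (ℕ → Bool) → List ℕ → ℕ
count P []       = 0
count P (x ∷ xs) = ⟦ P x ⟧ + count P xs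

module _ (P : ℕ → Bool) where

  length-filterᵇ : ∀ xs → length (filterᵇ P xs) ≡ count P xs
  length-filterᵇ []       = refl
  length-filterᵇ (x ∷ xs) with P x
  ... | true  = cong suc (length-filterᵇ xs)
  ... | false = length-filterᵇ xs

  count-++ : ∀ xs ys → count P (xs ++ ys) ≡ count P xs + count P ys
  count-++ []       ys = refl
  count-++ (x ∷ xs) ys rewrite count-++ xs ys = sym (+-assoc ⟦ P x ⟧ _ _)

  count-∷ʳ-false : ∀ xs {a} → P a ≡ false → count P (xs ∷ʳ a) ≡ count P xs
  count-∷ʳ-false xs {a} Pa≡false rewrite count-++ xs [ a ] | Pa≡false = +-identityʳ _

  count-↭ : ∀ {xs ys} → xs ↭ ys → count P xs ≡ count P ys
  count-↭ {xs} {ys} xs↭ys = begin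
    count P xs             ≡⟨ length-filterᵇ xs ⟨
    length (filterᵇ P xs)  ≡⟨ ↭-length (filter-↭ (T? ∘ P) xs↭ys) ⟩
    length (filterᵇ P ys)  ≡⟨ length-filterᵇ ys ⟩
    count P ys             ∎

  count-map : ∀ f xs → count P (map f xs) ≡ count (P ∘ f) xs
  count-map f []       = refl
  count-map f (x ∷ xs) = cong (⟦ P (f x) ⟧ +_) (count-map f xs)

  count-cong : ∀ {Q xs} → All (λ z → P z ≡ Q z) xs → count P xs ≡ count Q xs
  count-cong []             = refl
  count-cong (Pz≡Qz ∷ P≡Q) = cong₂ _+_ (cong ⟦_⟧ Pz≡Qz) (count-cong P≡Q)

  count-≤ : ∀ {Q} → (∀ z → T (P z) → T (Q z)) → ∀ xs → count P xs ≤ count Q xs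
  count-≤ P⇒Q []       = z≤n
  count-≤ P⇒Q (x ∷ xs) = +-mono-≤ (⟦⟧-mono (P⇒Q x)) (count-≤ P⇒Q xs)

  count-< : ∀ {Q} → (∀ z → T (P z) → T (Q z)) →
            ∀ {x xs} → x ∈ xs → ¬ T (P x) → T (Q x) → count P xs < count Q xs
  count-< P⇒Q {xs = _ ∷ xs} (here refl)  ¬Px Qx = +-mono-<-≤ (⟦⟧-< ¬Px Qx) (count-≤ P⇒Q xs)
  count-< P⇒Q {xs = y ∷ _}  (there x∈xs) ¬Px Qx =
    +-mono-≤-< (⟦⟧-mono (P⇒Q y)) (count-< P⇒Q x∈xs ¬Px Qx)

  count-+ : ∀ {Q R} → (∀ z → ⟦ P z ⟧ + ⟦ Q z ⟧ ≡ ⟦ R z ⟧) →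
            ∀ xs → count P xs + count Q xs ≡ count R xs
  count-+         P+Q≡R []       = refl
  count-+ {Q} {R} P+Q≡R (x ∷ xs) = begin
    (⟦ P x ⟧ + count P xs) + (⟦ Q x ⟧ + count Q xs)  ≡⟨ interchange +-commutativeSemigroup ⟦ P x ⟧ _ _ _ ⟩
    (⟦ P x ⟧ + ⟦ Q x ⟧) + (count P xs + count Q xs)  ≡⟨ cong₂ _+_ (P+Q≡R x) (count-+ P+Q≡R xs) ⟩
    ⟦ R x ⟧ + count R xs                             ∎

count-true : ∀ xs → count (λ _ → true) xs ≡ length xs
count-true []       = refl
count-true (_ ∷ xs) = cong suc (count-true xs)

count-≤-length : ∀ P xs → count P xs ≤ length xs
count-≤-length P xs = ≤-trans (count-≤ P (λ _ _ → _) xs) (≤-reflexive (count-true xs))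

count-pos : ∀ P {x xs} → x ∈ xs → T (P x) → 0 < count P xs
count-pos P x∈xs Px = ≤-<-trans z≤n (count-< (λ _ → false) (λ _ ()) x∈xs (λ ()) Px)

-- Cyclic intervals

arc : ℕ → ℕ → ℕ → Bool
arc p u = inCyc p (just u)

arc-base : ∀ x y → arc x y x ≡ false
arc-base x y with x ≤ᵇ y
... | true  rewrite <ᵇ-false (n≮n x) = refl
... | false rewrite <ᵇ-false (n≮n x) = refl

arc≡ : ∀ x y z → arc x y z ≡
  (if not (y <ᵇ x) then (x <ᵇ z) ∧ not (y <ᵇ z) else ((x <ᵇ z) ∨ not (y <ᵇ z)))
arc≡ x y z rewrite ≤ᵇ≡not<ᵇ x y | ≤ᵇ≡not<ᵇ z y = refl

module OrderType (t : List ℕ) where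

  rank : ℕ → ℕ
  rank x = count (_<ᵇ x) t

  rank-mono : ∀ {x y} → x ≤ y → rank x ≤ rank y
  rank-mono x≤y = count-≤ _ (λ z z<x → <⇒<ᵇ (<-≤-trans (<ᵇ⇒< z _ z<x) x≤y)) t

  rank-< : ∀ {x y} → x ∈ t → x < y → rank x < rank y
  rank-< {x} x∈t x<y = count-< _ (λ z z<x → <⇒<ᵇ (<-trans (<ᵇ⇒< z _ z<x) x<y)) x∈t
    (n≮n x ∘ <ᵇ⇒< x x) (<⇒<ᵇ x<y)

  rank-<⁻ : ∀ {x y} → rank x < rank y → x < y
  rank-<⁻ rx<ry = ≰⇒> (λ y≤x → <⇒≱ rx<ry (rank-mono y≤x))

  rank-bound : ∀ x → rank x < suc (length t)
  rank-bound x = s≤s (count-≤-length _ t)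

  rank-injective : ∀ {x y} → x ∈ t → y ∈ t → rank x ≡ rank y → x ≡ y
  rank-injective {x} {y} x∈t y∈t rx≡ry with <-cmp x y
  ... | tri< x<y _ _ = ⊥-elim (<-irrefl rx≡ry (rank-< x∈t x<y))
  ... | tri≈ _ x≡y _ = x≡y
  ... | tri> _ _ y<x = ⊥-elim (<-irrefl (sym rx≡ry) (rank-< y∈t y<x))

  <ᵇ-rank : ∀ {x y} → x ∈ t → (x <ᵇ y) ≡ (rank x <ᵇ rank y)
  <ᵇ-rank {x} {y} x∈t = T-⇔⇒≡
    (λ x<y → <⇒<ᵇ (rank-< x∈t (<ᵇ⇒< x y x<y)))
    (λ rx<ry → <⇒<ᵇ (rank-<⁻ {x} {y} (<ᵇ⇒< (rank x) (rank y) rx<ry)))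

  arc-rank : ∀ {x y} → x ∈ t → y ∈ t → ∀ z → arc x y z ≡ arc (rank x) (rank y) (rank z)
  arc-rank {x} {y} x∈t y∈t z
    rewrite arc≡ x y z | arc≡ (rank x) (rank y) (rank z)
          | <ᵇ-rank {y} {x} y∈t | <ᵇ-rank {x} {z} x∈t | <ᵇ-rank {y} {z} y∈t = refl

module _ {P : ℕ → ℕ → ℕ → Set} (P? : ∀ x y z → Dec (P x y z)) where

  allBelow³? : ∀ b → Dec (∀ {x} → x < b → ∀ {y} → y < b → ∀ {z} → z < b → P x y z)
  allBelow³? b = allUpTo? (λ x → allUpTo? (λ y → allUpTo? (P? x y) b) b) b

allBelow⁴? : ∀ {P : ℕ → ℕ → ℕ → ℕ → Set} → (∀ w x y z → Dec (P w x y z)) → ∀ b →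
  Dec (∀ {w} → w < b → ∀ {x} → x < b → ∀ {y} → y < b → ∀ {z} → z < b → P w x y z)
allBelow⁴? P? b = allUpTo? (λ w → allBelow³? (P? w) b) b

arc-split-below : ∀ {p} → p < 5 → ∀ {x} → x < 5 → ∀ {y} → y < 5 → ∀ {z} → z < 5 →
  T (arc p y x) → ⟦ arc x y z ⟧ + ⟦ arc p x z ⟧ ≡ ⟦ arc p y z ⟧
arc-split-below = toWitness {a? = allBelow⁴? (λ p x y z →
  T? (arc p y x) →-dec ⟦ arc x y z ⟧ + ⟦ arc p x z ⟧ ≟ ⟦ arc p y z ⟧) 5} _

arc-complement-below : ∀ {a} → a < 4 → ∀ {v} → v < 4 → ∀ {z} → z < 4 →
  a ≢ v → ⟦ arc a v z ⟧ + ⟦ arc v a z ⟧ ≡ 1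
arc-complement-below = toWitness {a? = allBelow³? (λ a v z →
  ¬? (a ≟ v) →-dec ⟦ arc a v z ⟧ + ⟦ arc v a z ⟧ ≟ 1) 4} _

arc-total-below : ∀ {p} → p < 4 → ∀ {a} → a < 4 → ∀ {v} → v < 4 →
  p ≢ a → p ≢ v → a ≢ v → T (arc p v a) ⊎ T (arc p a v)
arc-total-below = toWitness {a? = allBelow³? (λ p a v →
  ¬? (p ≟ a) →-dec ¬? (p ≟ v) →-dec ¬? (a ≟ v) →-dec (T? (arc p v a) ⊎-dec T? (arc p a v))) 4} _

arc-split : ∀ {p x y} z → T (arc p y x) → ⟦ arc x y z ⟧ + ⟦ arc p x z ⟧ ≡ ⟦ arc p y z ⟧
arc-split {p} {x} {y} z x∈⟧p,y⟧ = begin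
  ⟦ arc x y z ⟧ + ⟦ arc p x z ⟧
    ≡⟨ cong₂ (λ b c → ⟦ b ⟧ + ⟦ c ⟧) (arc-rank x∈ y∈ z) (arc-rank p∈ x∈ z) ⟩
  ⟦ arc (rank x) (rank y) (rank z) ⟧ + ⟦ arc (rank p) (rank x) (rank z) ⟧
    ≡⟨ arc-split-below (rank-bound p) (rank-bound x) (rank-bound y) (rank-bound z)
                       (subst T (arc-rank p∈ y∈ x) x∈⟧p,y⟧) ⟩
  ⟦ arc (rank p) (rank y) (rank z) ⟧
    ≡⟨ cong ⟦_⟧ (arc-rank p∈ y∈ z) ⟨
  ⟦ arc p y z ⟧ ∎
  where
  open OrderType (p ∷ x ∷ y ∷ z ∷ [])
  p∈ : p ∈ p ∷ x ∷ y ∷ z ∷ []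
  p∈ = here refl
  x∈ : x ∈ p ∷ x ∷ y ∷ z ∷ []
  x∈ = there (here refl)
  y∈ : y ∈ p ∷ x ∷ y ∷ z ∷ []
  y∈ = there (there (here refl))

arc-complement : ∀ {a v} z → a ≢ v → ⟦ arc a v z ⟧ + ⟦ arc v a z ⟧ ≡ 1
arc-complement {a} {v} z a≢v = begin
  ⟦ arc a v z ⟧ + ⟦ arc v a z ⟧
    ≡⟨ cong₂ (λ b c → ⟦ b ⟧ + ⟦ c ⟧) (arc-rank a∈ v∈ z) (arc-rank v∈ a∈ z) ⟩
  ⟦ arc (rank a) (rank v) (rank z) ⟧ + ⟦ arc (rank v) (rank a) (rank z) ⟧
    ≡⟨ arc-complement-below (rank-bound a) (rank-bound v) (rank-bound z)
                            (a≢v ∘ rank-injective a∈ v∈) ⟩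
  1 ∎
  where
  open OrderType (a ∷ v ∷ z ∷ [])
  a∈ : a ∈ a ∷ v ∷ z ∷ []
  a∈ = here refl
  v∈ : v ∈ a ∷ v ∷ z ∷ []
  v∈ = there (here refl)

arc-total : ∀ {p a v} → p ≢ a → p ≢ v → a ≢ v → T (arc p v a) ⊎ T (arc p a v)
arc-total {p} {a} {v} p≢a p≢v a≢v =
  Sum.map (subst T (sym (arc-rank p∈ v∈ a))) (subst T (sym (arc-rank p∈ a∈ v)))
    (arc-total-below (rank-bound p) (rank-bound a) (rank-bound v)
      (p≢a ∘ rank-injective p∈ a∈) (p≢v ∘ rank-injective p∈ v∈) (a≢v ∘ rank-injective a∈ v∈))
  where
  open OrderType (p ∷ a ∷ v ∷ [])
  p∈ : p ∈ p ∷ a ∷ v ∷ []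
  p∈ = here refl
  a∈ : a ∈ p ∷ a ∷ v ∷ []
  a∈ = there (here refl)
  v∈ : v ∈ p ∷ a ∷ v ∷ []
  v∈ = there (there (here refl))

arc-endpoint : ∀ {x y} → x ≢ y → T (arc x y y)
arc-endpoint {x} {y} x≢y = ⟦⟧≡1⇒T (subst (λ b → ⟦ b ⟧ + ⟦ arc x y y ⟧ ≡ 1) (arc-base y x)
                                           (arc-complement y (x≢y ∘ sym)))

-- Cyclic ranks and one step of 𝒞

cyclicRank : List ℕ → ℕ → ℕ → ℕ
cyclicRank w p u = count (arc p u) w

cyclicRank-split : ∀ w {p x y} → T (arc p y x) →
  cyclicRank w x y + cyclicRank w p x ≡ cyclicRank w p y
cyclicRank-split w x∈⟧p,y⟧ = count-+ _ (λ z → arc-split z x∈⟧p,y⟧) w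

cyclicRank-complement : ∀ w {a v} → a ≢ v → cyclicRank w a v + cyclicRank w v a ≡ length w
cyclicRank-complement w a≢v = trans (count-+ _ (λ z → arc-complement z a≢v) w) (count-true w)

cyclicRank-∷ʳ : ∀ ρ a v → cyclicRank (ρ ∷ʳ a) a v ≡ cyclicRank ρ a v
cyclicRank-∷ʳ ρ a v = count-∷ʳ-false _ ρ (arc-base a v)

shift : ℕ → ℕ → ℕ → ℕ
shift m x v = if v <ᵇ x then v + m ∸ x else v ∸ x

shift-≥ : ∀ m x d → shift m x (d + x) ≡ d
shift-≥ m x d rewrite <ᵇ-false (m+n≮n d x) = m+n∸n≡m d x

shift-< : ∀ c d v → 0 < d → shift (c + d) (d + v) v ≡ c
shift-< c d v d>0 rewrite <ᵇ-true (m<n+m v d>0) = begin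
  v + (c + d) ∸ (d + v)  ≡⟨ cong (_∸ (d + v)) (+-comm v (c + d)) ⟩
  c + d + v ∸ (d + v)    ≡⟨ cong (_∸ (d + v)) (+-assoc c d v) ⟩
  c + (d + v) ∸ (d + v)  ≡⟨ m+n∸n≡m c (d + v) ⟩
  c                      ∎

length-∷ʳ : ∀ (xs : List ℕ) x → length (xs ∷ʳ x) ≡ suc (length xs)
length-∷ʳ xs x = trans (length-++ xs) (+-comm (length xs) 1)

shift-cyclicRank : ∀ {ρ a p v} → a ∉ ρ → p ∉ ρ ∷ʳ a → v ∈ ρ →
  shift (suc (length ρ)) (cyclicRank (ρ ∷ʳ a) p a) (cyclicRank (ρ ∷ʳ a) p v) ≡ cyclicRank ρ a v
shift-cyclicRank {ρ} {a} {p} {v} a∉ρ p∉w v∈ρ = by-position (arc-total p≢a p≢v a≢v)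
  where
  w : List ℕ
  w = ρ ∷ʳ a
  m : ℕ
  m = suc (length ρ)
  F : ℕ → ℕ
  F = cyclicRank w p
  p≢a : p ≢ a
  p≢a refl = p∉w (∈-insert ρ)
  p≢v : p ≢ v
  p≢v refl = p∉w (∈-++⁺ˡ v∈ρ)
  a≢v : a ≢ v
  a≢v refl = a∉ρ v∈ρ
  by-position : T (arc p v a) ⊎ T (arc p a v) → shift m (F a) (F v) ≡ cyclicRank ρ a v
  by-position (inj₁ a∈⟧p,v⟧) = begin
    shift m (F a) (F v)                     ≡⟨ cong (shift m (F a)) (cyclicRank-split w a∈⟧p,v⟧) ⟨
    shift m (F a) (cyclicRank w a v + F a)  ≡⟨ shift-≥ m (F a) _ ⟩
    cyclicRank w a v                        ≡⟨ cyclicRank-∷ʳ ρ a v ⟩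
    cyclicRank ρ a v                        ∎
  by-position (inj₂ v∈⟧p,a⟧) = begin
    shift m (F a) (F v)
      ≡⟨ cong₂ (λ k x → shift k x (F v)) (trans (cyclicRank-complement w a≢v) (length-∷ʳ ρ a))
                                          (cyclicRank-split w v∈⟧p,a⟧) ⟨
    shift (cyclicRank w a v + cyclicRank w v a) (cyclicRank w v a + F v) (F v)
      ≡⟨ shift-< _ _ (F v) (count-pos _ (∈-insert ρ) (arc-endpoint (a≢v ∘ sym))) ⟩
    cyclicRank w a v  ≡⟨ cyclicRank-∷ʳ ρ a v ⟩
    cyclicRank ρ a v  ∎

initLast-∷ʳ : ∀ (xs : List ℕ) x → initLast (xs ∷ʳ x) ≡ (xs ∷ʳ′ x)
initLast-∷ʳ []       x = refl
initLast-∷ʳ (y ∷ xs) x rewrite initLast-∷ʳ xs x = refl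

𝒞-∷ʳ : ∀ xs x → 𝒞 (xs ∷ʳ x) ≡ Cx x xs
𝒞-∷ʳ xs x rewrite initLast-∷ʳ xs x = refl

last-∷ʳ : ∀ (xs : List ℕ) x → last (xs ∷ʳ x) ≡ just x
last-∷ʳ []           x = refl
last-∷ʳ (_ ∷ [])     x = refl
last-∷ʳ (_ ∷ y ∷ xs) x = last-∷ʳ (y ∷ xs) x

𝒞-step : ∀ {ρ a p} → a ∉ ρ → p ∉ ρ ∷ʳ a →
  𝒞 (map (cyclicRank (ρ ∷ʳ a) p) (ρ ∷ʳ a)) ≡ map (cyclicRank ρ a) ρ
𝒞-step {ρ} {a} {p} a∉ρ p∉w = begin
  𝒞 (map F (ρ ∷ʳ a))                                 ≡⟨ cong 𝒞 (map-++ F ρ [ a ]) ⟩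
  𝒞 (map F ρ ∷ʳ F a)                                 ≡⟨ 𝒞-∷ʳ (map F ρ) (F a) ⟩
  map (shift (suc (length (map F ρ))) (F a)) (map F ρ) ≡⟨ map-∘ ρ ⟨
  map (shift (suc (length (map F ρ))) (F a) ∘ F) ρ
    ≡⟨ cong (λ k → map (shift (suc k) (F a) ∘ F) ρ) (length-map F ρ) ⟩
  map (shift (suc (length ρ)) (F a) ∘ F) ρ
    ≡⟨ map-cong-local (All.tabulate (shift-cyclicRank a∉ρ p∉w)) ⟩
  map (cyclicRank ρ a) ρ                             ∎
  where
  F : ℕ → ℕ
  F = cyclicRank (ρ ∷ʳ a) p

-- Prefixes of a permutation

-- 0 stands for σ_{n+1} = ∞: on positive letters ⟧a, 0⟧ = ⟧a, ∞⟧.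
next : List ℕ → ℕ
next []      = 0
next (x ∷ _) = x

∉-prefix : ∀ (w : List ℕ) {y r} → Unique (w ++ y ∷ r) → y ∉ w
∉-prefix (x ∷ w) (x≢ ∷ _) (here refl)  = All.lookup x≢ (∈-insert w) refl
∉-prefix (x ∷ w) (_ ∷ u)  (there y∈w) = ∉-prefix w u y∈w

next∉ : ∀ {σ} → Unique σ → 0 ∉ σ → ∀ w r → w ++ r ≡ σ → next r ∉ w
next∉ _  0∉σ w []      refl 0∈w = 0∉σ (∈-++⁺ˡ 0∈w)
next∉ uσ _   w (_ ∷ _) refl     = ∉-prefix w uσ

𝒞^-prefix : ∀ {σ} → Unique σ → 0 ∉ σ → ∀ w r → w ++ r ≡ σ →
  𝒞^ (length r) (map (cyclicRank σ 0) σ) ≡ map (cyclicRank w (next r)) w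
𝒞^-prefix _ _ w [] refl = cong (λ s → map (cyclicRank s 0) s) (++-identityʳ w)
𝒞^-prefix {σ} uσ 0∉σ w (y ∷ r) w++y∷r≡σ = begin
  𝒞 (𝒞^ (length r) (map (cyclicRank σ 0) σ))
    ≡⟨ cong 𝒞 (𝒞^-prefix uσ 0∉σ (w ∷ʳ y) r w∷ʳy++r≡σ) ⟩
  𝒞 (map (cyclicRank (w ∷ʳ y) (next r)) (w ∷ʳ y))
    ≡⟨ 𝒞-step (next∉ uσ 0∉σ w (y ∷ r) w++y∷r≡σ) (next∉ uσ 0∉σ (w ∷ʳ y) r w∷ʳy++r≡σ) ⟩
  map (cyclicRank w y) w ∎
  where
  w∷ʳy++r≡σ : (w ∷ʳ y) ++ r ≡ σ
  w∷ʳy++r≡σ = trans (++-assoc w [ y ] r) w++y∷r≡σ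

take-length-++ : ∀ (xs : List ℕ) {ys} → take (length xs) (xs ++ ys) ≡ xs
take-length-++ []       = refl
take-length-++ (x ∷ xs) = cong (x ∷_) (take-length-++ xs)

drop-length-++ : ∀ (xs : List ℕ) {ys} → drop (length xs) (xs ++ ys) ≡ ys
drop-length-++ []       = refl
drop-length-++ (x ∷ xs) = drop-length-++ xs

<ᵇ≡arc-0 : ∀ {a z} → a ≢ 0 → z ≢ 0 → (a <ᵇ z) ≡ arc a 0 z
<ᵇ≡arc-0 {zero}          a≢0 _   = ⊥-elim (a≢0 refl)
<ᵇ≡arc-0 {suc _} {zero}  _   z≢0 = ⊥-elim (z≢0 refl)
<ᵇ≡arc-0 {suc a} {suc z} _   _   = sym (∨-identityʳ (a <ᵇ z))

sCode-prefix : ∀ ρ {a} r → 0 ∉ ρ ++ a ∷ r →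
  sCode (suc (length ρ)) (ρ ++ a ∷ r) ≡ cyclicRank ρ a (next r)
sCode-prefix ρ {a} [] 0∉ rewrite drop-length-++ ρ {a ∷ []} | take-length-++ ρ {a ∷ []} =
  trans (length-filterᵇ _ ρ) (count-cong _ (All.tabulate (λ z∈ρ → <ᵇ≡arc-0 a≢0 (z≢0 z∈ρ))))
  where
  a≢0 : a ≢ 0
  a≢0 refl = 0∉ (∈-insert ρ)
  z≢0 : ∀ {z} → z ∈ ρ → z ≢ 0
  z≢0 z∈ρ refl = 0∉ (∈-++⁺ˡ z∈ρ)
sCode-prefix ρ {a} (b ∷ r) _ rewrite drop-length-++ ρ {a ∷ b ∷ r} | take-length-++ ρ {a ∷ b ∷ r} =
  length-filterᵇ _ ρ

⊓-suc : ∀ m n → m ⊓ n + ⟦ n <ᵇ m ⟧ ≡ m ⊓ suc n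
⊓-suc zero    n       = refl
⊓-suc (suc m) zero    = cong suc (sym (⊓-zeroʳ m))
⊓-suc (suc m) (suc n) = cong suc (⊓-suc m n)

count-<ᵇ-upTo : ∀ v n → count (_<ᵇ v) (upTo n) ≡ v ⊓ n
count-<ᵇ-upTo v zero    = sym (⊓-zeroʳ v)
count-<ᵇ-upTo v (suc n) = begin
  count (_<ᵇ v) (upTo (suc n))               ≡⟨ cong (count _) (upTo-∷ʳ n) ⟨
  count (_<ᵇ v) (upTo n ∷ʳ n)                ≡⟨ count-++ _ (upTo n) [ n ] ⟩
  count (_<ᵇ v) (upTo n) + (⟦ n <ᵇ v ⟧ + 0)  ≡⟨ cong₂ _+_ (count-<ᵇ-upTo v n) (+-identityʳ _) ⟩
  v ⊓ n + ⟦ n <ᵇ v ⟧                         ≡⟨ ⊓-suc v n ⟩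
  v ⊓ suc n                                  ∎

∈-range⁻ : ∀ {n v} → v ∈ range n → 0 < v × v ≤ n
∈-range⁻ v∈ with ∈-map⁻ suc v∈
... | _ , u∈ , refl = s≤s z≤n , ∈-upTo⁻ u∈

module _ {n σ} (σ↭ : IsPerm n σ) where

  IsPerm⇒Unique : Unique σ
  IsPerm⇒Unique =
    Unique-resp-↭ (setoid ℕ) (↭⇒↭ₛ (↭-sym σ↭)) (Unique.map⁺ suc-injective (Unique.upTo⁺ n))

  IsPerm⇒0∉ : 0 ∉ σ
  IsPerm⇒0∉ 0∈σ = n≮n 0 (proj₁ (∈-range⁻ (∈-resp-↭ σ↭ 0∈σ)))

  IsPerm⇒length : length σ ≡ n
  IsPerm⇒length = trans (↭-length σ↭) (trans (length-map suc (upTo n)) (length-upTo n))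

  IsPerm⇒cyclicRank-0 : ∀ {v} → v ∈ σ → cyclicRank σ 0 v ≡ v
  IsPerm⇒cyclicRank-0 {v} v∈σ = begin
    count (arc 0 v) σ                   ≡⟨ count-↭ _ σ↭ ⟩
    count (arc 0 v) (map suc (upTo n))  ≡⟨ count-map _ suc (upTo n) ⟩
    count (_<ᵇ v) (upTo n)              ≡⟨ count-<ᵇ-upTo v n ⟩
    v ⊓ n                               ≡⟨ m≤n⇒m⊓n≡m (proj₂ (∈-range⁻ (∈-resp-↭ σ↭ v∈σ))) ⟩
    v                                   ∎

last-𝒞^+sCode : ∀ {n} ρ a r → IsPerm n (ρ ++ a ∷ r) →
  let σ = ρ ++ a ∷ r ; l = cyclicRank (ρ ∷ʳ a) (next r) a in
  last (𝒞^ (length r) σ) ≡ just l × sCode (suc (length ρ)) σ + l ≡ suc (length ρ)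
last-𝒞^+sCode ρ a r σ↭ = last-𝒞^ , sCode+last
  where
  σ w : List ℕ
  σ = ρ ++ a ∷ r
  w = ρ ∷ʳ a
  F : ℕ → ℕ
  F = cyclicRank w (next r)
  w++r≡σ : w ++ r ≡ σ
  w++r≡σ = ++-assoc ρ [ a ] r
  a≢next : a ≢ next r
  a≢next a≡p = next∉ (IsPerm⇒Unique σ↭) (IsPerm⇒0∉ σ↭) w r w++r≡σ (subst (_∈ w) a≡p (∈-insert ρ))
  last-𝒞^ : last (𝒞^ (length r) σ) ≡ just (F a)
  last-𝒞^ = begin
    last (𝒞^ (length r) σ)
      ≡⟨ cong (last ∘ 𝒞^ (length r)) (map-id-local (All.tabulate (IsPerm⇒cyclicRank-0 σ↭))) ⟨
    last (𝒞^ (length r) (map (cyclicRank σ 0) σ))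
      ≡⟨ cong last (𝒞^-prefix (IsPerm⇒Unique σ↭) (IsPerm⇒0∉ σ↭) w r w++r≡σ) ⟩
    last (map F w)        ≡⟨ last-map F w ⟩
    Maybe.map F (last w)  ≡⟨ cong (Maybe.map F) (last-∷ʳ ρ a) ⟩
    just (F a)            ∎
  sCode+last : sCode (suc (length ρ)) σ + F a ≡ suc (length ρ)
  sCode+last = begin
    sCode (suc (length ρ)) σ + F a  ≡⟨ cong (_+ F a) (sCode-prefix ρ r (IsPerm⇒0∉ σ↭)) ⟩
    cyclicRank ρ a (next r) + F a   ≡⟨ cong (_+ F a) (cyclicRank-∷ʳ ρ a (next r)) ⟨
    cyclicRank w a (next r) + F a   ≡⟨ cyclicRank-complement w a≢next ⟩
    length w                        ≡⟨ length-∷ʳ ρ a ⟩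
    suc (length ρ)                  ∎

split-at : ∀ (σ : List ℕ) {k} → k < length σ →
  ∃₂ λ ρ a → ∃ λ r → σ ≡ ρ ++ a ∷ r × k ≡ length ρ × length σ ∸ suc k ≡ length r
split-at (x ∷ σ) {zero}  _ = [] , x , σ , refl , refl , refl
split-at (x ∷ σ) {suc k} (s≤s k<|σ|) with ρ , a , r , refl , refl , |r| ← split-at σ k<|σ| =
  x ∷ ρ , a , r , refl , refl , |r|

corollary2p3 : (n : ℕ) → 1 ≤ n → (σ : List ℕ) → IsPerm n σ →
    (i : ℕ) → 1 ≤ i → i ≤ n →
    ∃ λ l → last (𝒞^ (n ∸ i) σ) ≡ just l × sCode i σ + l ≡ i
corollary2p3 n _ σ σ↭ (suc k) (s≤s z≤n) i≤n
  with ρ , a , r , refl , refl , |r| ← split-at σ (subst (suc k ≤_) (sym (IsPerm⇒length σ↭)) i≤n)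
  rewrite sym (IsPerm⇒length σ↭) | |r| = _ , last-𝒞^+sCode ρ a r σ↭
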